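{- Let $k \geq 1$ and $m \geq 1$ be integers, and let $(f^{(k)}_n)_{n\in\mathbb{Z}}$ be the $k$-generalized Fibonacci sequence defined by $f^{(k)}_n = 0$ for $n<0$, $f^{(k)}_0 = 1$, and $f^{(k)}_n = \sum_{i=1}^{k} f^{(k)}_{n-i}$ for $n \geq 1$. Then the sum of the first $mk$ nonzero terms of this sequence satisfies $$\sum_{n=0}^{mk-1} f^{(k)}_n \;=\; \sum_{i=1}^{m}\sum_{j=1}^{i}\frac{2^{(m-i+1)k}\,(-1)^{j-1}\, k^{j-1}\, S(i,j)\,(m-i+1)^{j-1}}{(i-1)!\cdot 2^{i}},$$ where $S(a,b)$ denotes the unsigned Stirling number of the first kind.
   Context: The unsigned Stirling numbers of the first kind $S(n,k)$ are defined by $S(0,0)=1$, $S(n,0)=S(0,k)=0$ for $n,k>0$, and $S(n,k) = (n-1)S(n-1,k) + S(n-1,k-1)$ for $n,k>0$; equivalently $x(x+1)\cdots(x+n-1) = \sum_{k} S(n,k)x^k$. The nonzero terms of the $k$-generalized Fibonacci sequence are $f^{(k)}_0, f^{(k)}_1, f^{(k)}_2,\dots$, so "the first $mk$ nonzero terms" are $f^{(k)}_0,\dots,f^{(k)}_{mk-1}$. -}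

module Defs where

open import Data.Nat using (ℕ; zero; suc; _+_; _*_)
open import Data.List using (List; []; _∷_; take)
open import Data.Nat.ListAction using (sum)
open import Data.Rational using (ℚ)
import Data.Rational as ℚ

-- hist k n = [ f⁽ᵏ⁾_{n-1} , f⁽ᵏ⁾_{n-2} , … , f⁽ᵏ⁾_0 ]  (most recent first)
-- next k h  = the next term given the history h of all previous terms:
--   f_0 = 1 ; f_n = Σ_{i=1}^{k} f_{n-i} for n ≥ 1, where f_j = 0 for j < 0
--   (terms with negative index contribute 0, so we sum the at most k
--    available previous terms).
next : ℕ → List ℕ → ℕ
next k []         = 1
next k h@(_ ∷ _)  = sum (take k h)

hist : ℕ → ℕ → List ℕ
hist k zero    = []
hist k (suc n) = next k (hist k n) ∷ hist k n

fib : ℕ → ℕ → ℕ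
fib k n = next k (hist k n)

sumBelow : (ℕ → ℕ) → ℕ → ℕ
sumBelow f zero    = 0
sumBelow f (suc n) = sumBelow f n + f n

stirling1 : ℕ → ℕ → ℕ
stirling1 zero    zero    = 1
stirling1 zero    (suc k) = 0
stirling1 (suc n) zero    = 0
stirling1 (suc n) (suc k) = n * stirling1 n (suc k) + stirling1 n k

sumℚ1 : ℕ → (ℕ → ℚ) → ℚ
sumℚ1 zero    g = ℚ.0ℚ
sumℚ1 (suc n) g = sumℚ1 n g ℚ.+ g (suc n)

{-# OPTIONS --safe #-}
module Submission where

-- With S(N) = Σ_{n<N} f⁽ᵏ⁾ₙ, the identity fₙ = S(n) − S(n−k) gives S(N+2) + S(N+1−k) = 2 S(N+1),
-- which with S(0) = 0 and S(1) = 1 determines S. By Pascal's rule the alternating sum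
-- Σₜ (−1)ᵗ (N−tk−1 choose t) 2^(N−tk−1−t) satisfies the same recurrence, so it is S(N).
-- For N = mk its t-th term, with x = (m−t)k, is the (i = t+1)-th row of the right-hand side:
-- Σⱼ S(i,j) z^(j−1) = (z+1)(z+2)⋯(z+i−1) is (−1)ᵗ (x−1)(x−2)⋯(x−t) at z = −x, and
-- 2^x (x−1)(x−2)⋯(x−t) = (x−1 choose t) 2^(x−1−t) · t! 2^(t+1).

open import Defs
open import Data.Nat using (ℕ; _≤_; _*_; _∸_; _+_; _^_; _!)
open import Data.Nat.Properties using (m*n≢0; m^n≢0; _!≢0)
open import Data.Integer using (+_; -1ℤ)
open import Data.Rational using (ℚ; _/_)
import Data.Rational as ℚ
open import Relation.Binary.PropositionalEquality using (_≡_)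

open import Algebra.Bundles using (Semiring)
open import Data.Nat using (zero; suc; _<_; s≤s; z≤n; NonZero; ≢-nonZero)
import Data.Nat.Properties as ℕ
open import Data.Nat.Combinatorics.Base using (_P′_)
open import Data.Nat.Combinatorics.Specification using (P′-rec)
open import Data.Integer using (ℤ; 1ℤ; 0ℤ; -_)
import Data.Integer as ℤ
import Data.Integer.Properties as ℤ
open import Data.Integer.Tactic.RingSolver using (solve-∀)
open import Data.Nat.Tactic.RingSolver renaming (solve-∀ to ℕ-solve-∀)
open import Data.Sum using (inj₁; inj₂)
import Data.Rational.Properties as ℚ
open import Data.Rational.Unnormalised using (mkℚᵘ; *≡*)
import Data.Rational.Unnormalised as ℚᵘ
import Data.Rational.Unnormalised.Properties as ℚᵘ
open import Data.List using (take; drop; _++_)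
open import Data.List.Properties using (take++drop≡id)
open import Data.Nat.ListAction using (sum)
open import Data.Nat.ListAction.Properties using (sum-++)
open import Algebra.Properties.AbelianGroup ℤ.+-0-abelianGroup using () renaming (∙-cancelʳ to +-cancelʳ)
open import Relation.Binary.PropositionalEquality using (refl; sym; trans; cong; cong₂; module ≡-Reasoning)

module FiniteSum {c ℓ} (R : Semiring c ℓ) where

  open Semiring R
    renaming (_+_ to _+ᴿ_; _*_ to _*ᴿ_; refl to ≈-refl; sym to ≈-sym; trans to ≈-trans)
  open import Algebra.Properties.CommutativeSemigroup +-commutativeSemigroup using (interchange)

  ∑ : ℕ → (ℕ → Carrier) → Carrier
  ∑ zero    f = 0#
  ∑ (suc n) f = ∑ n f +ᴿ f n

  syntax ∑ n (λ j → e) = ∑[ j < n ] e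

  ∑-cong : ∀ n {f g} → (∀ j → j < n → f j ≈ g j) → ∑ n f ≈ ∑ n g
  ∑-cong zero    f≈g = ≈-refl
  ∑-cong (suc n) f≈g = +-cong (∑-cong n (λ j j<n → f≈g j (ℕ.m<n⇒m<1+n j<n))) (f≈g n ℕ.≤-refl)

  ∑-distrib-+ : ∀ n f g → ∑[ j < n ] (f j +ᴿ g j) ≈ ∑ n f +ᴿ ∑ n g
  ∑-distrib-+ zero    f g = ≈-sym (+-identityˡ 0#)
  ∑-distrib-+ (suc n) f g = ≈-trans (+-congʳ (∑-distrib-+ n f g)) (interchange _ _ _ _)

  *-distribˡ-∑ : ∀ n x f → x *ᴿ ∑ n f ≈ ∑[ j < n ] (x *ᴿ f j)
  *-distribˡ-∑ zero    x f = zeroʳ x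
  *-distribˡ-∑ (suc n) x f = ≈-trans (distribˡ x _ _) (+-congʳ (*-distribˡ-∑ n x f))

  ∑-suc : ∀ n f → ∑ (suc n) f ≈ f 0 +ᴿ ∑[ j < n ] f (suc j)
  ∑-suc zero    f = +-comm 0# (f 0)
  ∑-suc (suc n) f = ≈-trans (+-congʳ (∑-suc n f)) (+-assoc _ _ _)

  ∑-vanishing-tail : ∀ f {L n} → L ≤ n → (∀ j → L ≤ j → f j ≈ 0#) → ∑ n f ≈ ∑ L f
  ∑-vanishing-tail f {L} {n} L≤n vanish with ℕ.m≤n⇒m<n∨m≡n L≤n
  ... | inj₂ refl = ≈-refl
  ∑-vanishing-tail f {n = suc n} _ vanish | inj₁ (s≤s L≤n) =
    ≈-trans (+-cong (∑-vanishing-tail f L≤n vanish) (vanish n L≤n)) (+-identityʳ _)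

open FiniteSum ℤ.+-*-semiring

pos-*-+ : ∀ a b c → + (a * b + c) ≡ + a ℤ.* + b ℤ.+ + c
pos-*-+ a b c = trans (ℤ.pos-+ (a * b) c) (cong (ℤ._+ + c) (ℤ.pos-* a b))

rising : ℤ → ℕ → ℤ
rising x zero    = 1ℤ
rising x (suc n) = rising x n ℤ.* (x ℤ.+ + n)

stirlingPoly : ℕ → ℤ → ℤ
stirlingPoly n x = ∑[ j < n ] (+ stirling1 n (suc j) ℤ.* x ℤ.^ j)

stirling1-vanishes : ∀ {n k} → n < k → stirling1 n k ≡ 0
stirling1-vanishes {zero}  {suc k} _          = refl
stirling1-vanishes {suc n} {suc k} (s≤s n<k) =
  cong₂ _+_ (trans (cong (n *_) (stirling1-vanishes (ℕ.m<n⇒m<1+n n<k))) (ℕ.*-zeroʳ n)) (stirling1-vanishes n<k)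

stirlingPoly-suc : ∀ n x → stirlingPoly (suc (suc n)) x ≡ (x ℤ.+ + suc n) ℤ.* stirlingPoly (suc n) x
stirlingPoly-suc n x = begin
  ∑[ j < suc (suc n) ] (+ stirling1 (suc (suc n)) (suc j) ℤ.* x ℤ.^ j)
    ≡⟨ ∑-cong (suc (suc n)) (λ j _ → pascal j) ⟩
  ∑[ j < suc (suc n) ] (+ suc n ℤ.* (+ S (suc j) ℤ.* x ℤ.^ j) ℤ.+ + S j ℤ.* x ℤ.^ j)
    ≡⟨ ∑-distrib-+ (suc (suc n)) _ _ ⟩
  ∑[ j < suc (suc n) ] (+ suc n ℤ.* (+ S (suc j) ℤ.* x ℤ.^ j)) ℤ.+ ∑[ j < suc (suc n) ] (+ S j ℤ.* x ℤ.^ j)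
    ≡⟨ cong₂ ℤ._+_ (sym (*-distribˡ-∑ (suc (suc n)) (+ suc n) _)) (∑-suc (suc n) _) ⟩
  + suc n ℤ.* (P ℤ.+ + S (suc (suc n)) ℤ.* x ℤ.^ suc n)
    ℤ.+ (+ 0 ℤ.* 1ℤ ℤ.+ ∑[ j < suc n ] (+ S (suc j) ℤ.* (x ℤ.* x ℤ.^ j)))
    ≡⟨ cong₂ (λ s q → + suc n ℤ.* (P ℤ.+ + s ℤ.* x ℤ.^ suc n) ℤ.+ (+ 0 ℤ.* 1ℤ ℤ.+ q))
             (stirling1-vanishes {suc n} ℕ.≤-refl) factor-x ⟩
  + suc n ℤ.* (P ℤ.+ + 0 ℤ.* x ℤ.^ suc n) ℤ.+ (+ 0 ℤ.* 1ℤ ℤ.+ x ℤ.* P)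
    ≡⟨ collect (+ suc n) P x (x ℤ.^ suc n) ⟩
  (x ℤ.+ + suc n) ℤ.* P ∎
  where
  open ≡-Reasoning
  S = stirling1 (suc n)
  P = stirlingPoly (suc n) x
  pascal : ∀ j → + stirling1 (suc (suc n)) (suc j) ℤ.* x ℤ.^ j
               ≡ + suc n ℤ.* (+ S (suc j) ℤ.* x ℤ.^ j) ℤ.+ + S j ℤ.* x ℤ.^ j
  pascal j = trans (cong (ℤ._* x ℤ.^ j) (pos-*-+ (suc n) (S (suc j)) (S j)))
                   (distrib (+ suc n) (+ S (suc j)) (+ S j) (x ℤ.^ j))
    where
    distrib : ∀ a b c w → (a ℤ.* b ℤ.+ c) ℤ.* w ≡ a ℤ.* (b ℤ.* w) ℤ.+ c ℤ.* w
    distrib = solve-∀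
  factor-x : ∑[ j < suc n ] (+ S (suc j) ℤ.* (x ℤ.* x ℤ.^ j)) ≡ x ℤ.* P
  factor-x = trans (∑-cong (suc n) (λ j _ → swap (+ S (suc j)) x (x ℤ.^ j)))
                   (sym (*-distribˡ-∑ (suc n) x _))
    where
    swap : ∀ a b c → a ℤ.* (b ℤ.* c) ≡ b ℤ.* (a ℤ.* c)
    swap = solve-∀
  collect : ∀ a p y w → a ℤ.* (p ℤ.+ + 0 ℤ.* w) ℤ.+ (+ 0 ℤ.* 1ℤ ℤ.+ y ℤ.* p) ≡ (y ℤ.+ a) ℤ.* p
  collect = solve-∀

stirlingPoly≡rising : ∀ n x → stirlingPoly (suc n) x ≡ rising (x ℤ.+ 1ℤ) n
stirlingPoly≡rising zero    x = refl
stirlingPoly≡rising (suc n) x = begin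
  stirlingPoly (suc (suc n)) x
    ≡⟨ stirlingPoly-suc n x ⟩
  (x ℤ.+ + suc n) ℤ.* stirlingPoly (suc n) x
    ≡⟨ cong₂ (λ s p → (x ℤ.+ s) ℤ.* p) (ℤ.pos-+ 1 n) (stirlingPoly≡rising n x) ⟩
  (x ℤ.+ (1ℤ ℤ.+ + n)) ℤ.* rising (x ℤ.+ 1ℤ) n
    ≡⟨ reorder x (+ n) (rising (x ℤ.+ 1ℤ) n) ⟩
  rising (x ℤ.+ 1ℤ) n ℤ.* (x ℤ.+ 1ℤ ℤ.+ + n) ∎
  where
  open ≡-Reasoning
  reorder : ∀ x n r → (x ℤ.+ (1ℤ ℤ.+ n)) ℤ.* r ≡ r ℤ.* (x ℤ.+ 1ℤ ℤ.+ n)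
  reorder = solve-∀

k>n⇒nP′k≡0 : ∀ {n k} → n < k → n P′ k ≡ 0
k>n⇒nP′k≡0 {n} {suc k} (s≤s n≤k) with ℕ.m≤n⇒m<n∨m≡n n≤k
... | inj₁ n<k  = trans (cong ((n ∸ k) *_) (k>n⇒nP′k≡0 n<k)) (ℕ.*-zeroʳ (n ∸ k))
... | inj₂ refl = cong (_* (n P′ n)) (ℕ.n∸n≡0 n)

P′-suc-suc : ∀ n k → suc n P′ suc k ≡ suc k * (n P′ k) + n P′ suc k
P′-suc-suc n k with ℕ.≤-<-connex k n
... | inj₁ k≤n = P′-rec (s≤s k≤n)
... | inj₂ n<k = trans (k>n⇒nP′k≡0 (s≤s n<k))
  (sym (trans (cong₂ (λ p q → suc k * p + q) (k>n⇒nP′k≡0 n<k) (k>n⇒nP′k≡0 (ℕ.m<n⇒m<1+n n<k)))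
              (cong (_+ 0) (ℕ.*-zeroʳ (suc k)))))

[k-n]*nP′k≡-nP′[1+k] : ∀ n k → (+ k ℤ.- + n) ℤ.* + (n P′ k) ≡ - + (n P′ suc k)
[k-n]*nP′k≡-nP′[1+k] n k with ℕ.≤-<-connex k n
... | inj₁ k≤n = begin
  (+ k ℤ.- + n) ℤ.* + (n P′ k)                 ≡⟨ cong (λ a → (+ k ℤ.- a) ℤ.* + (n P′ k)) n≡k+[n∸k] ⟩
  (+ k ℤ.- (+ k ℤ.+ + (n ∸ k))) ℤ.* + (n P′ k) ≡⟨ cancel (+ k) (+ (n ∸ k)) (+ (n P′ k)) ⟩
  - (+ (n ∸ k) ℤ.* + (n P′ k))                 ≡⟨ cong -_ (sym (ℤ.pos-* (n ∸ k) (n P′ k))) ⟩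
  - + (n P′ suc k)                             ∎
  where
  open ≡-Reasoning
  n≡k+[n∸k] : + n ≡ + k ℤ.+ + (n ∸ k)
  n≡k+[n∸k] = trans (cong +_ (sym (ℕ.m+[n∸m]≡n k≤n))) (ℤ.pos-+ k (n ∸ k))
  cancel : ∀ a d p → (a ℤ.- (a ℤ.+ d)) ℤ.* p ≡ - (d ℤ.* p)
  cancel = solve-∀
... | inj₂ n<k = begin
  (+ k ℤ.- + n) ℤ.* + (n P′ k) ≡⟨ cong (λ p → (+ k ℤ.- + n) ℤ.* + p) (k>n⇒nP′k≡0 n<k) ⟩
  (+ k ℤ.- + n) ℤ.* 0ℤ         ≡⟨ ℤ.*-zeroʳ (+ k ℤ.- + n) ⟩
  0ℤ                           ≡⟨ cong (λ p → - + p) (sym (k>n⇒nP′k≡0 (ℕ.m<n⇒m<1+n n<k))) ⟩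
  - + (n P′ suc k)             ∎
  where open ≡-Reasoning

rising-neg : ∀ n k → rising (- + n) k ≡ -1ℤ ℤ.^ k ℤ.* + (n P′ k)
rising-neg n zero    = refl
rising-neg n (suc k) = begin
  rising (- + n) k ℤ.* (- + n ℤ.+ + k)
    ≡⟨ cong (ℤ._* (- + n ℤ.+ + k)) (rising-neg n k) ⟩
  -1ℤ ℤ.^ k ℤ.* + (n P′ k) ℤ.* (- + n ℤ.+ + k)
    ≡⟨ regroup (-1ℤ ℤ.^ k) (+ (n P′ k)) (+ n) (+ k) ⟩
  -1ℤ ℤ.* -1ℤ ℤ.^ k ℤ.* - ((+ k ℤ.- + n) ℤ.* + (n P′ k))
    ≡⟨ cong (λ p → -1ℤ ℤ.* -1ℤ ℤ.^ k ℤ.* - p) ([k-n]*nP′k≡-nP′[1+k] n k) ⟩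
  -1ℤ ℤ.* -1ℤ ℤ.^ k ℤ.* - - + (n P′ suc k)
    ≡⟨ cong (-1ℤ ℤ.* -1ℤ ℤ.^ k ℤ.*_) (ℤ.neg-involutive _) ⟩
  -1ℤ ℤ.* -1ℤ ℤ.^ k ℤ.* + (n P′ suc k) ∎
  where
  open ≡-Reasoning
  regroup : ∀ s p n k → s ℤ.* p ℤ.* (- n ℤ.+ k) ≡ -1ℤ ℤ.* s ℤ.* - ((k ℤ.- n) ℤ.* p)
  regroup = solve-∀

-- binom₂ w t = (w−1 choose t)·2^(w−1−t), the coefficient of xᵗ in (2 + x)^(w−1), for w ≥ 1.
-- The value binom₂ 0 t = 0 is what makes the terms with tk ≥ N of closedForm vanish despite truncated subtraction.
binom₂ : ℕ → ℕ → ℕ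
binom₂ zero          t       = 0
binom₂ (suc w)       (suc t) = 2 * binom₂ w (suc t) + binom₂ w t
binom₂ (suc zero)    zero    = 1
binom₂ (suc (suc w)) zero    = 2 * binom₂ (suc w) zero

binom₂-vanishes : ∀ {w t} → w ≤ t → binom₂ w t ≡ 0
binom₂-vanishes {zero}              _         = refl
binom₂-vanishes {suc w} {suc t} (s≤s w≤t) =
  cong₂ (λ a b → 2 * a + b) (binom₂-vanishes (ℕ.m≤n⇒m≤1+n w≤t)) (binom₂-vanishes w≤t)

binom₂-zero : ∀ n → binom₂ (suc n) 0 ≡ 2 ^ n
binom₂-zero zero    = refl
binom₂-zero (suc n) = cong (2 *_) (binom₂-zero n)

binom₂-falling : ∀ n k → binom₂ (suc n) k * (k ! * 2 ^ k) ≡ 2 ^ n * (n P′ k)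
binom₂-falling n       zero    = cong (_* 1) (binom₂-zero n)
binom₂-falling zero    (suc k) = sym (cong (1 *_) (k>n⇒nP′k≡0 {0} {suc k} (s≤s z≤n)))
binom₂-falling (suc n) (suc k) = begin
  (2 * B₁ + B₀) * (suc k * k ! * (2 * 2 ^ k))
    ≡⟨ expand B₁ B₀ k (k !) (2 ^ k) ⟩
  2 * (B₁ * (suc k ! * 2 ^ suc k)) + 2 * suc k * (B₀ * (k ! * 2 ^ k))
    ≡⟨ cong₂ (λ a b → 2 * a + 2 * suc k * b) (binom₂-falling n (suc k)) (binom₂-falling n k) ⟩
  2 * (2 ^ n * (n P′ suc k)) + 2 * suc k * (2 ^ n * (n P′ k))
    ≡⟨ collect (2 ^ n) (n P′ suc k) k (n P′ k) ⟩
  2 * 2 ^ n * (suc k * (n P′ k) + n P′ suc k)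
    ≡⟨ cong (2 * 2 ^ n *_) (sym (P′-suc-suc n k)) ⟩
  2 * 2 ^ n * (suc n P′ suc k) ∎
  where
  open ≡-Reasoning
  B₁ = binom₂ (suc n) (suc k)
  B₀ = binom₂ (suc n) k
  expand : ∀ b₁ b₀ k f p → (2 * b₁ + b₀) * (suc k * f * (2 * p))
                         ≡ 2 * (b₁ * (suc k * f * (2 * p))) + 2 * suc k * (b₀ * (f * p))
  expand = ℕ-solve-∀
  collect : ∀ q a k b → 2 * (q * a) + 2 * suc k * (q * b) ≡ 2 * q * (suc k * b + a)
  collect = ℕ-solve-∀

stirlingPoly-at-negative : ∀ n k .{{_ : NonZero n}} →
  + (2 ^ n) ℤ.* stirlingPoly (suc k) (- + n) ≡ -1ℤ ℤ.^ k ℤ.* + binom₂ n k ℤ.* + (k ! * 2 ^ suc k)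
stirlingPoly-at-negative (suc n) k = begin
  + (2 ^ suc n) ℤ.* stirlingPoly (suc k) (- + suc n)
    ≡⟨ cong (+ (2 ^ suc n) ℤ.*_) (stirlingPoly≡rising k (- + suc n)) ⟩
  + (2 ^ suc n) ℤ.* rising (- + suc n ℤ.+ 1ℤ) k
    ≡⟨ cong (λ x → + (2 ^ suc n) ℤ.* rising x k) shift ⟩
  + (2 ^ suc n) ℤ.* rising (- + n) k
    ≡⟨ cong (+ (2 ^ suc n) ℤ.*_) (rising-neg n k) ⟩
  + (2 ^ suc n) ℤ.* (-1ℤ ℤ.^ k ℤ.* + (n P′ k))
    ≡⟨ swap (+ (2 ^ suc n)) (-1ℤ ℤ.^ k) (+ (n P′ k)) ⟩
  -1ℤ ℤ.^ k ℤ.* (+ (2 ^ suc n) ℤ.* + (n P′ k))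
    ≡⟨ cong (-1ℤ ℤ.^ k ℤ.*_) (sym (ℤ.pos-* (2 ^ suc n) (n P′ k))) ⟩
  -1ℤ ℤ.^ k ℤ.* + (2 * 2 ^ n * (n P′ k))
    ≡⟨ cong (λ a → -1ℤ ℤ.^ k ℤ.* + a) (ℕ.*-assoc 2 (2 ^ n) (n P′ k)) ⟩
  -1ℤ ℤ.^ k ℤ.* + (2 * (2 ^ n * (n P′ k)))
    ≡⟨ cong (λ a → -1ℤ ℤ.^ k ℤ.* + (2 * a)) (sym (binom₂-falling n k)) ⟩
  -1ℤ ℤ.^ k ℤ.* + (2 * (B * (k ! * 2 ^ k)))
    ≡⟨ cong (λ a → -1ℤ ℤ.^ k ℤ.* + a) (double-denominator B (k !) (2 ^ k)) ⟩
  -1ℤ ℤ.^ k ℤ.* + (B * (k ! * 2 ^ suc k))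
    ≡⟨ cong (-1ℤ ℤ.^ k ℤ.*_) (ℤ.pos-* B (k ! * 2 ^ suc k)) ⟩
  -1ℤ ℤ.^ k ℤ.* (+ B ℤ.* + (k ! * 2 ^ suc k))
    ≡⟨ sym (ℤ.*-assoc (-1ℤ ℤ.^ k) (+ B) _) ⟩
  -1ℤ ℤ.^ k ℤ.* + B ℤ.* + (k ! * 2 ^ suc k) ∎
  where
  open ≡-Reasoning
  B = binom₂ (suc n) k
  shift : - + suc n ℤ.+ 1ℤ ≡ - + n
  shift = trans (cong (λ x → - x ℤ.+ 1ℤ) (ℤ.pos-+ 1 n)) (cancel (+ n))
    where
    cancel : ∀ a → - (1ℤ ℤ.+ a) ℤ.+ 1ℤ ≡ - a
    cancel = solve-∀
  swap : ∀ a b c → a ℤ.* (b ℤ.* c) ≡ b ℤ.* (a ℤ.* c)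
  swap = solve-∀
  double-denominator : ∀ b f p → 2 * (b * (f * p)) ≡ b * (f * (2 * p))
  double-denominator = ℕ-solve-∀

-[m*n]^k : ∀ m n k → (- + (m * n)) ℤ.^ k ≡ -1ℤ ℤ.^ k ℤ.* + (n ^ k * m ^ k)
-[m*n]^k m n zero    = refl
-[m*n]^k m n (suc k) = begin
  - + (m * n) ℤ.* (- + (m * n)) ℤ.^ k
    ≡⟨ cong₂ (λ a b → - a ℤ.* b) (ℤ.pos-* m n) (-[m*n]^k m n k) ⟩
  - (+ m ℤ.* + n) ℤ.* (-1ℤ ℤ.^ k ℤ.* + (n ^ k * m ^ k))
    ≡⟨ cong (λ a → - (+ m ℤ.* + n) ℤ.* (-1ℤ ℤ.^ k ℤ.* a)) (ℤ.pos-* (n ^ k) (m ^ k)) ⟩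
  - (+ m ℤ.* + n) ℤ.* (-1ℤ ℤ.^ k ℤ.* (+ (n ^ k) ℤ.* + (m ^ k)))
    ≡⟨ regroup (+ m) (+ n) (-1ℤ ℤ.^ k) (+ (n ^ k)) (+ (m ^ k)) ⟩
  -1ℤ ℤ.* -1ℤ ℤ.^ k ℤ.* (+ n ℤ.* + (n ^ k) ℤ.* (+ m ℤ.* + (m ^ k)))
    ≡⟨ cong (-1ℤ ℤ.* -1ℤ ℤ.^ k ℤ.*_) (sym (cong₂ ℤ._*_ (ℤ.pos-* n (n ^ k)) (ℤ.pos-* m (m ^ k)))) ⟩
  -1ℤ ℤ.* -1ℤ ℤ.^ k ℤ.* (+ (n ^ suc k) ℤ.* + (m ^ suc k))
    ≡⟨ cong (-1ℤ ℤ.* -1ℤ ℤ.^ k ℤ.*_) (sym (ℤ.pos-* (n ^ suc k) (m ^ suc k))) ⟩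
  -1ℤ ℤ.* -1ℤ ℤ.^ k ℤ.* + (n ^ suc k * m ^ suc k) ∎
  where
  open ≡-Reasoning
  regroup : ∀ m n s a b → - (m ℤ.* n) ℤ.* (s ℤ.* (a ℤ.* b)) ≡ -1ℤ ℤ.* s ℤ.* (n ℤ.* a ℤ.* (m ℤ.* b))
  regroup = solve-∀

stirling1-row-sum : ∀ k r t .{{_ : NonZero (r * k)}} →
  ∑[ e < suc t ] (+ (2 ^ (r * k)) ℤ.* (-1ℤ ℤ.^ e) ℤ.* + (k ^ e * stirling1 (suc t) (suc e) * r ^ e))
    ≡ -1ℤ ℤ.^ t ℤ.* + binom₂ (r * k) t ℤ.* + (t ! * 2 ^ suc t)
stirling1-row-sum k r t = begin
  ∑[ e < suc t ] (+ (2 ^ (r * k)) ℤ.* (-1ℤ ℤ.^ e) ℤ.* + (k ^ e * stirling1 (suc t) (suc e) * r ^ e))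
    ≡⟨ ∑-cong (suc t) (λ e _ → monomial e) ⟩
  ∑[ e < suc t ] (+ (2 ^ (r * k)) ℤ.* (+ stirling1 (suc t) (suc e) ℤ.* (- + (r * k)) ℤ.^ e))
    ≡⟨ sym (*-distribˡ-∑ (suc t) (+ (2 ^ (r * k))) _) ⟩
  + (2 ^ (r * k)) ℤ.* stirlingPoly (suc t) (- + (r * k))
    ≡⟨ stirlingPoly-at-negative (r * k) t ⟩
  -1ℤ ℤ.^ t ℤ.* + binom₂ (r * k) t ℤ.* + (t ! * 2 ^ suc t) ∎
  where
  open ≡-Reasoning
  monomial : ∀ e → + (2 ^ (r * k)) ℤ.* (-1ℤ ℤ.^ e) ℤ.* + (k ^ e * stirling1 (suc t) (suc e) * r ^ e)
                 ≡ + (2 ^ (r * k)) ℤ.* (+ stirling1 (suc t) (suc e) ℤ.* (- + (r * k)) ℤ.^ e)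
  monomial e = begin
    + p ℤ.* σ ℤ.* + (k ^ e * s * r ^ e)      ≡⟨ cong (λ a → + p ℤ.* σ ℤ.* + a) (middle (k ^ e) s (r ^ e)) ⟩
    + p ℤ.* σ ℤ.* + (s * (k ^ e * r ^ e))    ≡⟨ cong (+ p ℤ.* σ ℤ.*_) (ℤ.pos-* s (k ^ e * r ^ e)) ⟩
    + p ℤ.* σ ℤ.* (+ s ℤ.* + (k ^ e * r ^ e)) ≡⟨ regroup (+ p) σ (+ s) (+ (k ^ e * r ^ e)) ⟩
    + p ℤ.* (+ s ℤ.* (σ ℤ.* + (k ^ e * r ^ e))) ≡⟨ cong (λ a → + p ℤ.* (+ s ℤ.* a)) (sym (-[m*n]^k r k e)) ⟩
    + p ℤ.* (+ s ℤ.* (- + (r * k)) ℤ.^ e)    ∎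
    where
    p = 2 ^ (r * k)
    σ = -1ℤ ℤ.^ e
    s = stirling1 (suc t) (suc e)
    middle : ∀ a b c → a * b * c ≡ b * (a * c)
    middle = ℕ-solve-∀
    regroup : ∀ p σ s q → p ℤ.* σ ℤ.* (s ℤ.* q) ≡ p ℤ.* (s ℤ.* (σ ℤ.* q))
    regroup = solve-∀

PartialSumRecurrence : ℕ → (ℕ → ℤ) → Set
PartialSumRecurrence k X = ∀ n → X (suc (suc n)) ℤ.+ X (suc n ∸ k) ≡ + 2 ℤ.* X (suc n)

PartialSumRecurrence-unique : ∀ {k X Y} → PartialSumRecurrence k X → PartialSumRecurrence k Y →
                              X 0 ≡ Y 0 → X 1 ≡ Y 1 → ∀ n → X n ≡ Y n
PartialSumRecurrence-unique {k} {X} {Y} recX recY X0≡Y0 X1≡Y1 n = agree n ℕ.≤-refl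
  where
  agree : ∀ {N} n → n ≤ N → X n ≡ Y n
  agree zero          _ = X0≡Y0
  agree (suc zero)    _ = X1≡Y1
  agree {suc N} (suc (suc n)) (s≤s n<N) = +-cancelʳ (X (suc n ∸ k)) _ _ (begin
    X (suc (suc n)) ℤ.+ X (suc n ∸ k) ≡⟨ recX n ⟩
    + 2 ℤ.* X (suc n)                 ≡⟨ cong (+ 2 ℤ.*_) (agree (suc n) n<N) ⟩
    + 2 ℤ.* Y (suc n)                 ≡⟨ sym (recY n) ⟩
    Y (suc (suc n)) ℤ.+ Y (suc n ∸ k) ≡⟨ cong (ℤ._+_ (Y (suc (suc n)))) (sym (agree (suc n ∸ k) n∸k<N)) ⟩
    Y (suc (suc n)) ℤ.+ X (suc n ∸ k) ∎)
    where
    open ≡-Reasoning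
    n∸k<N : suc n ∸ k ≤ N
    n∸k<N = ℕ.≤-trans (ℕ.m∸n≤m (suc n) k) n<N

sum-hist : ∀ k n → sum (hist k n) ≡ sumBelow (fib k) n
sum-hist k zero    = refl
sum-hist k (suc n) = trans (cong (_+_ (fib k n)) (sum-hist k n)) (ℕ.+-comm (fib k n) _)

drop-hist : ∀ k j n → drop j (hist k n) ≡ hist k (n ∸ j)
drop-hist k zero    n       = refl
drop-hist k (suc j) zero    = refl
drop-hist k (suc j) (suc n) = drop-hist k j n

fib-suc : ∀ k n → fib k (suc n) + sumBelow (fib k) (suc n ∸ k) ≡ sumBelow (fib k) (suc n)
fib-suc k n = begin
  sum (take k h) + sumBelow (fib k) (suc n ∸ k) ≡⟨ cong (_+_ (sum (take k h))) (sym sum-drop) ⟩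
  sum (take k h) + sum (drop k h)               ≡⟨ sym (sum-++ (take k h) (drop k h)) ⟩
  sum (take k h ++ drop k h)                    ≡⟨ cong sum (take++drop≡id k h) ⟩
  sum h                                         ≡⟨ sum-hist k (suc n) ⟩
  sumBelow (fib k) (suc n)                      ∎
  where
  open ≡-Reasoning
  h = hist k (suc n)
  sum-drop : sum (drop k h) ≡ sumBelow (fib k) (suc n ∸ k)
  sum-drop = trans (cong sum (drop-hist k k (suc n))) (sum-hist k (suc n ∸ k))

sumBelow-fib-rec : ∀ k → PartialSumRecurrence k (λ n → + sumBelow (fib k) n)
sumBelow-fib-rec k n = begin
  + (S (suc n) + fib k (suc n)) ℤ.+ + S (suc n ∸ k) ≡⟨ sym (ℤ.pos-+ (S (suc n) + fib k (suc n)) _) ⟩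
  + (S (suc n) + fib k (suc n) + S (suc n ∸ k))     ≡⟨ cong +_ (ℕ.+-assoc (S (suc n)) _ _) ⟩
  + (S (suc n) + (fib k (suc n) + S (suc n ∸ k)))   ≡⟨ cong (λ a → + (S (suc n) + a)) (fib-suc k n) ⟩
  + (S (suc n) + S (suc n))                         ≡⟨ cong (λ a → + (S (suc n) + a)) (sym (ℕ.+-identityʳ (S (suc n)))) ⟩
  + (2 * S (suc n))                                 ≡⟨ ℤ.pos-* 2 (S (suc n)) ⟩
  + 2 ℤ.* + S (suc n)                               ∎
  where
  open ≡-Reasoning
  S = sumBelow (fib k)

closedFormTerm : ℕ → ℕ → ℕ → ℤ
closedFormTerm k N t = -1ℤ ℤ.^ t ℤ.* + binom₂ (N ∸ t * k) t

closedForm : ℕ → ℕ → ℤ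
closedForm k N = ∑[ t < N ] closedFormTerm k N t

closedFormTerm-vanishes : ∀ k {N t} → N ∸ t * k ≤ t → closedFormTerm k N t ≡ 0ℤ
closedFormTerm-vanishes k {N} {t} le =
  trans (cong (λ b → -1ℤ ℤ.^ t ℤ.* + b) (binom₂-vanishes le)) (ℤ.*-zeroʳ (-1ℤ ℤ.^ t))

binom₂-∸-rec : ∀ k N s → binom₂ (suc N ∸ suc s * k) (suc s)
                       ≡ 2 * binom₂ (N ∸ suc s * k) (suc s) + binom₂ (N ∸ k ∸ s * k) s
binom₂-∸-rec k N s rewrite ℕ.∸-+-assoc N k (s * k) with ℕ.≤-<-connex (suc s * k) N
... | inj₁ sk≤N rewrite ℕ.+-∸-assoc 1 sk≤N = refl
... | inj₂ N<sk rewrite ℕ.m≤n⇒m∸n≡0 N<sk | ℕ.m≤n⇒m∸n≡0 (ℕ.<⇒≤ N<sk) = refl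

closedFormTerm-rec : ∀ k N s → closedFormTerm k (suc N) (suc s) ℤ.+ closedFormTerm k (N ∸ k) s
                             ≡ + 2 ℤ.* closedFormTerm k N (suc s)
closedFormTerm-rec k N s = begin
  -1ℤ ℤ.* σ ℤ.* + binom₂ (suc N ∸ suc s * k) (suc s) ℤ.+ σ ℤ.* + b₀
    ≡⟨ cong (λ b → -1ℤ ℤ.* σ ℤ.* + b ℤ.+ σ ℤ.* + b₀) (binom₂-∸-rec k N s) ⟩
  -1ℤ ℤ.* σ ℤ.* + (2 * b₁ + b₀) ℤ.+ σ ℤ.* + b₀
    ≡⟨ cong (λ b → -1ℤ ℤ.* σ ℤ.* b ℤ.+ σ ℤ.* + b₀) (pos-*-+ 2 b₁ b₀) ⟩
  -1ℤ ℤ.* σ ℤ.* (+ 2 ℤ.* + b₁ ℤ.+ + b₀) ℤ.+ σ ℤ.* + b₀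
    ≡⟨ cancel σ (+ b₁) (+ b₀) ⟩
  + 2 ℤ.* (-1ℤ ℤ.* σ ℤ.* + b₁) ∎
  where
  open ≡-Reasoning
  σ = -1ℤ ℤ.^ s
  b₁ = binom₂ (N ∸ suc s * k) (suc s)
  b₀ = binom₂ (N ∸ k ∸ s * k) s
  cancel : ∀ σ a b → -1ℤ ℤ.* σ ℤ.* (+ 2 ℤ.* a ℤ.+ b) ℤ.+ σ ℤ.* b ≡ + 2 ℤ.* (-1ℤ ℤ.* σ ℤ.* a)
  cancel = solve-∀

closedFormTerm-rec-zero : ∀ k N → closedFormTerm k (suc (suc N)) 0 ≡ + 2 ℤ.* closedFormTerm k (suc N) 0
closedFormTerm-rec-zero k N = begin
  1ℤ ℤ.* + (2 * b)    ≡⟨ ℤ.*-identityˡ _ ⟩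
  + (2 * b)           ≡⟨ ℤ.pos-* 2 b ⟩
  + 2 ℤ.* + b         ≡⟨ cong (+ 2 ℤ.*_) (sym (ℤ.*-identityˡ _)) ⟩
  + 2 ℤ.* (1ℤ ℤ.* + b) ∎
  where
  open ≡-Reasoning
  b = binom₂ (suc N) 0

closedForm-rec : ∀ k → PartialSumRecurrence k (closedForm k)
closedForm-rec k n = begin
  closedForm k (suc M) ℤ.+ closedForm k (M ∸ k)
    ≡⟨ cong₂ ℤ._+_ (∑-suc M (T (suc M))) (sym (∑-vanishing-tail (T (M ∸ k)) (ℕ.m∸n≤m M k) vanish)) ⟩
  T (suc M) 0 ℤ.+ ∑[ s < M ] T (suc M) (suc s) ℤ.+ ∑[ s < M ] T (M ∸ k) s
    ≡⟨ ℤ.+-assoc (T (suc M) 0) (∑[ s < M ] T (suc M) (suc s)) (∑[ s < M ] T (M ∸ k) s) ⟩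
  T (suc M) 0 ℤ.+ (∑[ s < M ] T (suc M) (suc s) ℤ.+ ∑[ s < M ] T (M ∸ k) s)
    ≡⟨ cong (ℤ._+_ (T (suc M) 0)) (sym (∑-distrib-+ M _ _)) ⟩
  T (suc M) 0 ℤ.+ ∑[ s < M ] (T (suc M) (suc s) ℤ.+ T (M ∸ k) s)
    ≡⟨ cong₂ ℤ._+_ (closedFormTerm-rec-zero k n) (∑-cong M (λ s _ → closedFormTerm-rec k M s)) ⟩
  + 2 ℤ.* T M 0 ℤ.+ ∑[ s < M ] (+ 2 ℤ.* T M (suc s))
    ≡⟨ cong (ℤ._+_ (+ 2 ℤ.* T M 0)) (sym (*-distribˡ-∑ M (+ 2) _)) ⟩
  + 2 ℤ.* T M 0 ℤ.+ + 2 ℤ.* ∑[ s < M ] T M (suc s)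
    ≡⟨ sym (ℤ.*-distribˡ-+ (+ 2) (T M 0) (∑[ s < M ] T M (suc s))) ⟩
  + 2 ℤ.* (T M 0 ℤ.+ ∑[ s < M ] T M (suc s))
    ≡⟨ cong (+ 2 ℤ.*_) (sym (∑-suc M (T M))) ⟩
  + 2 ℤ.* ∑ (suc M) (T M)
    ≡⟨ cong (+ 2 ℤ.*_) (∑-vanishing-tail (T M) (ℕ.n≤1+n M) vanish) ⟩
  + 2 ℤ.* closedForm k M ∎
  where
  open ≡-Reasoning
  M = suc n
  T = closedFormTerm k
  vanish : ∀ {N} t → N ≤ t → T N t ≡ 0ℤ
  vanish {N} t N≤t = closedFormTerm-vanishes k (ℕ.≤-trans (ℕ.m∸n≤m N (t * k)) N≤t)

sumBelow-fib≡closedForm : ∀ k n → + sumBelow (fib k) n ≡ closedForm k n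
sumBelow-fib≡closedForm k = PartialSumRecurrence-unique {k} (sumBelow-fib-rec k) (closedForm-rec k) refl refl

closedForm-multiple : ∀ k m .{{_ : NonZero k}} →
  closedForm k (m * k) ≡ ∑[ t < m ] (-1ℤ ℤ.^ t ℤ.* + binom₂ ((m ∸ t) * k) t)
closedForm-multiple k m = trans (∑-vanishing-tail (closedFormTerm k (m * k)) (ℕ.m≤m*n m k) vanish)
                                (∑-cong m {g = λ t → -1ℤ ℤ.^ t ℤ.* + binom₂ ((m ∸ t) * k) t} factor-k)
  where
  factor-k : ∀ t → t < m → closedFormTerm k (m * k) t ≡ -1ℤ ℤ.^ t ℤ.* + binom₂ ((m ∸ t) * k) t
  factor-k t _ = cong (λ w → -1ℤ ℤ.^ t ℤ.* + binom₂ w t) (sym (ℕ.*-distribʳ-∸ k m t))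
  vanish : ∀ t → m ≤ t → closedFormTerm k (m * k) t ≡ 0ℤ
  vanish t m≤t = closedFormTerm-vanishes k {m * k} {t}
    (ℕ.≤-trans (ℕ.≤-reflexive (ℕ.m≤n⇒m∸n≡0 (ℕ.*-monoˡ-≤ k m≤t))) z≤n)

fromℚᵘ-homo-+ : ∀ p q → ℚ.fromℚᵘ (p ℚᵘ.+ q) ≡ ℚ.fromℚᵘ p ℚ.+ ℚ.fromℚᵘ q
fromℚᵘ-homo-+ p q = ℚ.toℚᵘ-injective (ℚᵘ.≃-trans (ℚ.toℚᵘ-fromℚᵘ (p ℚᵘ.+ q))
  (ℚᵘ.≃-sym (ℚᵘ.≃-trans (ℚ.toℚᵘ-homo-+ (ℚ.fromℚᵘ p) (ℚ.fromℚᵘ q))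
                         (ℚᵘ.+-cong (ℚ.toℚᵘ-fromℚᵘ p) (ℚ.toℚᵘ-fromℚᵘ q)))))

/-distribʳ-+ : ∀ p q d .{{_ : NonZero d}} → (p ℤ.+ q) / d ≡ p / d ℚ.+ q / d
/-distribʳ-+ p q (suc d) =
  trans (ℚ.fromℚᵘ-cong (ℚᵘ.≃-sym (*≡* {mkℚᵘ p d ℚᵘ.+ mkℚᵘ q d} {mkℚᵘ (p ℤ.+ q) d} common-denominator)))
        (fromℚᵘ-homo-+ (mkℚᵘ p d) (mkℚᵘ q d))
  where
  common-denominator : (p ℤ.* + suc d ℤ.+ q ℤ.* + suc d) ℤ.* + suc d ≡ (p ℤ.+ q) ℤ.* + (suc d * suc d)
  common-denominator = trans (factor p q (+ suc d)) (cong ((p ℤ.+ q) ℤ.*_) (sym (ℤ.pos-* (suc d) (suc d))))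
    where
    factor : ∀ a b e → (a ℤ.* e ℤ.+ b ℤ.* e) ℤ.* e ≡ (a ℤ.+ b) ℤ.* (e ℤ.* e)
    factor = solve-∀

*-/-cancelʳ : ∀ p d .{{_ : NonZero d}} → (p ℤ.* + d) / d ≡ p / 1
*-/-cancelʳ p (suc d) =
  ℚ.fromℚᵘ-cong (*≡* {mkℚᵘ (p ℤ.* + suc d) d} {mkℚᵘ p 0} (ℤ.*-identityʳ (p ℤ.* + suc d)))

sumℚ1-cong : ∀ n {f g} → (∀ j → j < n → f (suc j) ≡ g (suc j)) → sumℚ1 n f ≡ sumℚ1 n g
sumℚ1-cong zero    f≡g = refl
sumℚ1-cong (suc n) f≡g = cong₂ ℚ._+_ (sumℚ1-cong n (λ j j<n → f≡g j (ℕ.m<n⇒m<1+n j<n))) (f≡g n ℕ.≤-refl)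

sumℚ1-/ : ∀ n (g : ℕ → ℤ) d .{{_ : NonZero d}} → sumℚ1 n (λ j → g j / d) ≡ (∑[ j < n ] g (suc j)) / d
sumℚ1-/ zero    g d = sym (ℚ.0/n≡0 d)
sumℚ1-/ (suc n) g d = trans (cong (ℚ._+ g (suc n) / d) (sumℚ1-/ n g d))
                             (sym (/-distribʳ-+ (∑[ j < n ] g (suc j)) (g (suc n)) d))

sumℚ1-/-cancel : ∀ n (g : ℕ → ℤ) y d .{{_ : NonZero d}} →
  ∑[ j < n ] g (suc j) ≡ y ℤ.* + d → sumℚ1 n (λ j → g j / d) ≡ y / 1
sumℚ1-/-cancel n g y d numerators≡yd =
  trans (sumℚ1-/ n g d) (trans (cong (_/ d) numerators≡yd) (*-/-cancelʳ y d))

rhsNumerator : ℕ → ℕ → ℕ → ℕ → ℤ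
rhsNumerator k m i j =
  + (2 ^ ((m ∸ i + 1) * k)) ℤ.* (-1ℤ ℤ.^ (j ∸ 1)) ℤ.* + (k ^ (j ∸ 1) * stirling1 i j * (m ∸ i + 1) ^ (j ∸ 1))

rhs-row-sum : ∀ k m t .{{_ : NonZero k}} → t < m →
  ∑[ e < suc t ] rhsNumerator k m (suc t) (suc e) ≡ -1ℤ ℤ.^ t ℤ.* + binom₂ ((m ∸ t) * k) t ℤ.* + (t ! * 2 ^ suc t)
rhs-row-sum k m t t<m =
  trans (stirling1-row-sum k (m ∸ suc t + 1) t {{m*n≢0 (m ∸ suc t + 1) k {{≢-nonZero (ℕ.m+1+n≢0 (m ∸ suc t))}}}})
        (cong (λ r → -1ℤ ℤ.^ t ℤ.* + binom₂ (r * k) t ℤ.* + (t ! * 2 ^ suc t)) m∸[1+t]+1≡m∸t)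
  where
  m∸[1+t]+1≡m∸t : m ∸ suc t + 1 ≡ m ∸ t
  m∸[1+t]+1≡m∸t = trans (ℕ.+-comm (m ∸ suc t) 1) (sym (ℕ.+-∸-assoc 1 t<m))

theorem1 : (k m : ℕ) → 1 ≤ k → 1 ≤ m →
    (+ sumBelow (fib k) (m * k)) / 1
      ≡ sumℚ1 m (λ i → sumℚ1 i (λ j →
          _/_ ((+ (2 ^ ((m ∸ i + 1) * k)) Data.Integer.* (-1ℤ Data.Integer.^ (j ∸ 1))
                 Data.Integer.* + (k ^ (j ∸ 1) * stirling1 i j * (m ∸ i + 1) ^ (j ∸ 1))))
              (((i ∸ 1) !) * 2 ^ i)
              ⦃ m*n≢0 ((i ∸ 1) !) (2 ^ i) ⦃ (i ∸ 1) !≢0 ⦄ ⦃ m^n≢0 2 i ⦄ ⦄))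
-- The identity holds for m = 0 as well (both sides are 0).
theorem1 k@(suc _) m _ _ = begin
  + sumBelow (fib k) (m * k) / 1
    ≡⟨ cong (_/ 1) (trans (sumBelow-fib≡closedForm k (m * k)) (closedForm-multiple k m)) ⟩
  (∑[ t < m ] y (suc t)) / 1
    ≡⟨ sym (sumℚ1-/ m y 1) ⟩
  sumℚ1 m (λ i → y i / 1)
    ≡⟨ sumℚ1-cong m (λ t t<m → sym (sumℚ1-/-cancel (suc t) (rhsNumerator k m (suc t)) (y (suc t))
                                       (t ! * 2 ^ suc t) {{denominator≢0 t}} (rhs-row-sum k m t t<m))) ⟩
  _ ∎
  where
  open ≡-Reasoning
  y : ℕ → ℤ
  y i = -1ℤ ℤ.^ (i ∸ 1) ℤ.* + binom₂ ((m ∸ (i ∸ 1)) * k) (i ∸ 1)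
  denominator≢0 : ∀ t → NonZero (t ! * 2 ^ suc t)
  denominator≢0 t = m*n≢0 (t !) (2 ^ suc t) {{t !≢0}} {{m^n≢0 2 (suc t)}}
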